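{- Let $\mathbf{C}$ be a category with finite products and let $\mathbb{T}=(T,\eta,(-)^{\sharp})$ be a Kleene monad on $\mathbf{C}$. Then: 1. For every object $S$ for which the required exponentials exist, the state monad transform $T_S X=(T(X\times S))^{S}$ of $\mathbb{T}$ is a Kleene monad. 2. For every monoid $(M,\varepsilon,\bullet)$ in $\mathbf{C}$, if $\mathbb{T}$ is strong with strength $\tau_{X,Y}\colon X\times TY\to T(X\times Y)$ and the strength respects the Kleene monad structure in the sense that $\tau\circ(\mathrm{id}\times\bot)=\bot$, $\tau\circ(\mathrm{id}\times(f\vee g))=\tau\circ(\mathrm{id}\times f)\vee\tau\circ(\mathrm{id}\times g)$ for all $f,g\colon X\to TY$, and $\tau\circ(\mathrm{id}\times f^{*})=(\tau\circ(\mathrm{id}\times f))^{*}$ for all $f\colon X\to TX$ (with $\bot,\vee,(-)^{*}$ those of the Kleisli category of $\mathbb{T}$), then the writer monad transform $T(M\times -)$ of $\mathbb{T}$ is a Kleene monad.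
   Context: A monad is given as a Kleisli triple $(T,\eta,(-)^{\sharp})$ with $\eta^{\sharp}=\mathrm{id}$, $f^{\sharp}\eta=f$, $(f^{\sharp}g)^{\sharp}=f^{\sharp}g^{\sharp}$; its Kleisli category $\mathbf{C}_{\mathbb{T}}$ has morphisms $X\to TY$, composition $f\cdot g=f^{\sharp}\circ g$ and identities $\eta$. A category is a Kleene–Kozen category if every hom-set is a join-semilattice with least element $\bot$, composition preserves binary joins and $\bot$ in each argument, and there is an operator $(-)^{*}$ on endomorphisms such that for all $f\colon Y\to Y$, $g\colon Y\to Z$, $h\colon X\to Y$, $g\circ f^{*}$ is the least (pre-)fixpoint of $x\mapsto g\vee x\circ f$ and $f^{*}\circ h$ is the least (pre-)fixpoint of $x\mapsto h\vee f\circ x$ (order: $f\le g$ iff $f\vee g=g$). A monad $\mathbb{T}$ is a Kleene monad if its Kleisli category is a Kleene–Kozen category. The state monad transform $T_S X=(T(X\times S))^{S}$ is the monad whose Kleisli morphisms $X\to T_S Y$ correspond (by currying) to morphisms $X\times S\to T(Y\times S)$, with unit and Kleisli composition corresponding to those of $\mathbb{T}$ on such morphisms. The writer monad transform has $T_M X=T(M\times X)$, unit $\eta\circ\langle\varepsilon\circ !,\mathrm{id}\rangle$, and for $f\colon X\to T(M\times Y)$ one sets $f^{\circ}\colon M\times X\to T(M\times Y)$ to be $T(\bullet\times\mathrm{id})\circ T(\alpha)\circ\tau\circ(\mathrm{id}\times f)$ where $\alpha\colon M\times(M\times Y)\cong(M\times M)\times Y$ is the associativity isomorphism; the Kleisli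 composite of $f\colon X\to T(M\times Y)$ followed by $g\colon Y\to T(M\times Z)$ is $g^{\circ}\cdot f$ (Kleisli composition of $\mathbb{T}$). -}

module Defs where

open import Level using (Level; _⊔_; suc)
open import Data.Product using (_×_; Σ)
open import Relation.Binary using (Rel; IsEquivalence)
open import Algebra.Structures using (IsIdempotentCommutativeMonoid)

record Category (o ℓ e : Level) : Set (suc (o ⊔ ℓ ⊔ e)) where
  infix  4 _≈_ _⇒_
  infixr 9 _∘_
  field
    Obj   : Set o
    _⇒_   : Obj → Obj → Set ℓ
    _≈_   : ∀ {A B} → Rel (A ⇒ B) e
    id    : ∀ {A} → A ⇒ A
    _∘_   : ∀ {A B C} → B ⇒ C → A ⇒ B → A ⇒ C
    equiv     : ∀ {A B} → IsEquivalence (_≈_ {A} {B})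
    ∘-resp-≈  : ∀ {A B C} {f h : B ⇒ C} {g i : A ⇒ B} →
                f ≈ h → g ≈ i → f ∘ g ≈ h ∘ i
    assoc     : ∀ {A B C D} {f : A ⇒ B} {g : B ⇒ C} {h : C ⇒ D} →
                (h ∘ g) ∘ f ≈ h ∘ (g ∘ f)
    identityˡ : ∀ {A B} {f : A ⇒ B} → id ∘ f ≈ f
    identityʳ : ∀ {A B} {f : A ⇒ B} → f ∘ id ≈ f

record FiniteProducts {o ℓ e} (C : Category o ℓ e) : Set (o ⊔ ℓ ⊔ e) where
  open Category C
  infixr 7 _×ₒ_
  field
    ⊤       : Obj
    !       : ∀ {A} → A ⇒ ⊤
    !-unique : ∀ {A} (f : A ⇒ ⊤) → f ≈ !
    _×ₒ_    : Obj → Obj → Obj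
    π₁      : ∀ {A B} → A ×ₒ B ⇒ A
    π₂      : ∀ {A B} → A ×ₒ B ⇒ B
    ⟨_,_⟩   : ∀ {X A B} → X ⇒ A → X ⇒ B → X ⇒ A ×ₒ B
    project₁ : ∀ {X A B} {f : X ⇒ A} {g : X ⇒ B} → π₁ ∘ ⟨ f , g ⟩ ≈ f
    project₂ : ∀ {X A B} {f : X ⇒ A} {g : X ⇒ B} → π₂ ∘ ⟨ f , g ⟩ ≈ g
    unique   : ∀ {X A B} {h : X ⇒ A ×ₒ B} {f : X ⇒ A} {g : X ⇒ B} →
               π₁ ∘ h ≈ f → π₂ ∘ h ≈ g → ⟨ f , g ⟩ ≈ h

  infixr 8 _⁂_
  _⁂_ : ∀ {A B C D} → A ⇒ B → C ⇒ D → A ×ₒ C ⇒ B ×ₒ D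
  f ⁂ g = ⟨ f ∘ π₁ , g ∘ π₂ ⟩

  assocʳ : ∀ {A B C} → (A ×ₒ B) ×ₒ C ⇒ A ×ₒ (B ×ₒ C)
  assocʳ = ⟨ π₁ ∘ π₁ , ⟨ π₂ ∘ π₁ , π₂ ⟩ ⟩

  assocˡ : ∀ {A B C} → A ×ₒ (B ×ₒ C) ⇒ (A ×ₒ B) ×ₒ C
  assocˡ = ⟨ ⟨ π₁ , π₁ ∘ π₂ ⟩ , π₂ ∘ π₂ ⟩

record Exponential {o ℓ e} {C : Category o ℓ e} (P : FiniteProducts C)
                   (A B : Category.Obj C) : Set (o ⊔ ℓ ⊔ e) where
  open Category C
  open FiniteProducts P
  field
    B^A    : Obj
    eval   : B^A ×ₒ A ⇒ B
    λg     : ∀ {X} → X ×ₒ A ⇒ B → X ⇒ B^A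
    β      : ∀ {X} {f : X ×ₒ A ⇒ B} → eval ∘ (λg f ⁂ id) ≈ f
    λ-unique : ∀ {X} {f : X ×ₒ A ⇒ B} {g : X ⇒ B^A} →
               eval ∘ (g ⁂ id) ≈ f → g ≈ λg f

record KleisliData {o ℓ e} (C : Category o ℓ e) : Set (o ⊔ ℓ) where
  open Category C
  field
    T   : Obj → Obj
    η   : ∀ {X} → X ⇒ T X
    _♯  : ∀ {X Y} → X ⇒ T Y → T X ⇒ T Y

record IsKleisliTriple {o ℓ e} {C : Category o ℓ e} (K : KleisliData C)
                       : Set (o ⊔ ℓ ⊔ e) where
  open Category C
  open KleisliData K
  field
    ♯-resp-≈ : ∀ {X Y} {f g : X ⇒ T Y} → f ≈ g → f ♯ ≈ g ♯
    η♯       : ∀ {X} → η {X} ♯ ≈ id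
    ♯η       : ∀ {X Y} {f : X ⇒ T Y} → f ♯ ∘ η ≈ f
    ♯♯       : ∀ {X Y Z} {f : Y ⇒ T Z} {g : X ⇒ T Y} →
               (f ♯ ∘ g) ♯ ≈ f ♯ ∘ g ♯

module _ {o ℓ e} {C : Category o ℓ e} (K : KleisliData C) where
  open Category C
  open KleisliData K
  Tmap : ∀ {X Y} → X ⇒ Y → T X ⇒ T Y
  Tmap f = (η ∘ f) ♯

record RawCat (o ℓ e : Level) : Set (suc (o ⊔ ℓ ⊔ e)) where
  infix 4 _≈_
  field
    Obj : Set o
    Hom : Obj → Obj → Set ℓ
    _≈_ : ∀ {A B} → Rel (Hom A B) e
    _∘_ : ∀ {A B C} → Hom B C → Hom A B → Hom A C
    id  : ∀ {A} → Hom A A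

Kleisli : ∀ {o ℓ e} {C : Category o ℓ e} → KleisliData C → RawCat o ℓ e
Kleisli {C = C} K = record
  { Obj = Obj
  ; Hom = λ X Y → X ⇒ T Y
  ; _≈_ = _≈_
  ; _∘_ = λ g f → g ♯ ∘ f
  ; id  = η
  }
  where open Category C
        open KleisliData K

record KleeneKozen {o ℓ e} (R : RawCat o ℓ e) : Set (o ⊔ ℓ ⊔ e) where
  open RawCat R
  infixr 6 _∨_
  field
    _∨_ : ∀ {A B} → Hom A B → Hom A B → Hom A B
    ⊥   : ∀ {A B} → Hom A B
    _*  : ∀ {A} → Hom A A → Hom A A

  _≤_ : ∀ {A B} → Hom A B → Hom A B → Set e
  f ≤ g = (f ∨ g) ≈ g

  field
    semilattice : ∀ {A B} → IsIdempotentCommutativeMonoid (_≈_ {A} {B}) _∨_ ⊥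
    ∘-∨ˡ : ∀ {A B C} {g : Hom B C} {f₁ f₂ : Hom A B} →
           g ∘ (f₁ ∨ f₂) ≈ (g ∘ f₁) ∨ (g ∘ f₂)
    ∘-∨ʳ : ∀ {A B C} {g₁ g₂ : Hom B C} {f : Hom A B} →
           (g₁ ∨ g₂) ∘ f ≈ (g₁ ∘ f) ∨ (g₂ ∘ f)
    ∘-⊥ˡ : ∀ {A B C} {g : Hom B C} → g ∘ ⊥ {A} {B} ≈ ⊥
    ∘-⊥ʳ : ∀ {A B C} {f : Hom A B} → ⊥ {B} {C} ∘ f ≈ ⊥
    *-fixʳ   : ∀ {Y Z} {f : Hom Y Y} {g : Hom Y Z} →
               (g ∨ ((g ∘ (f *)) ∘ f)) ≤ (g ∘ (f *))
    *-leastʳ : ∀ {Y Z} {f : Hom Y Y} {g : Hom Y Z} {x : Hom Y Z} →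
               (g ∨ (x ∘ f)) ≤ x → (g ∘ (f *)) ≤ x
    *-fixˡ   : ∀ {X Y} {f : Hom Y Y} {h : Hom X Y} →
               (h ∨ (f ∘ ((f *) ∘ h))) ≤ ((f *) ∘ h)
    *-leastˡ : ∀ {X Y} {f : Hom Y Y} {h : Hom X Y} {x : Hom X Y} →
               (h ∨ (f ∘ x)) ≤ x → ((f *) ∘ h) ≤ x

KleeneMonad : ∀ {o ℓ e} {C : Category o ℓ e} → KleisliData C → Set (o ⊔ ℓ ⊔ e)
KleeneMonad K = IsKleisliTriple K × KleeneKozen (Kleisli K)

module _ {o ℓ e} {C : Category o ℓ e} (P : FiniteProducts C)
         (K : KleisliData C) (S : Category.Obj C)
         (exp : ∀ X → Exponential P S (KleisliData.T K (FiniteProducts._×ₒ_ P X S)))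
         where
  open Category C
  open FiniteProducts P
  open KleisliData K
  private
    module E X = Exponential (exp X)

  uncurryS : ∀ {X Y} → X ⇒ E.B^A Y → X ×ₒ S ⇒ T (Y ×ₒ S)
  uncurryS {Y = Y} f = E.eval Y ∘ (f ⁂ id)

  StateT : KleisliData C
  StateT = record
    { T  = λ X → E.B^A X
    ; η  = λ {X} → E.λg X η
    ; _♯ = λ {X} {Y} f → E.λg Y ((uncurryS f) ♯ ∘ E.eval X)
    }

record IsMonoidObj {o ℓ e} {C : Category o ℓ e} (P : FiniteProducts C)
                   (M : Category.Obj C)
                   (ε : Category._⇒_ C (FiniteProducts.⊤ P) M)
                   (_•_ : Category._⇒_ C (FiniteProducts._×ₒ_ P M M) M)
                   : Set e where
  open Category C
  open FiniteProducts P
  field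
    •-assoc : _•_ ∘ (_•_ ⁂ id) ≈ _•_ ∘ (id ⁂ _•_) ∘ assocʳ
    •-unitˡ : _•_ ∘ ⟨ ε ∘ ! , id ⟩ ≈ id
    •-unitʳ : _•_ ∘ ⟨ id , ε ∘ ! ⟩ ≈ id

Strength : ∀ {o ℓ e} {C : Category o ℓ e} → FiniteProducts C → KleisliData C → Set (o ⊔ ℓ)
Strength {C = C} P K = ∀ {X Y} → X ×ₒ T Y ⇒ T (X ×ₒ Y)
  where open Category C
        open FiniteProducts P
        open KleisliData K

record IsStrength {o ℓ e} {C : Category o ℓ e} (P : FiniteProducts C)
                  (K : KleisliData C) (τ : Strength P K) : Set (o ⊔ ℓ ⊔ e) where
  open Category C
  open FiniteProducts P
  open KleisliData K
  field
    natural : ∀ {A A′ B B′} {f : A ⇒ A′} {g : B ⇒ B′} →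
              τ ∘ (f ⁂ Tmap K g) ≈ Tmap K (f ⁂ g) ∘ τ
    unit    : ∀ {A} → Tmap K π₂ ∘ τ {⊤} {A} ≈ π₂
    assoc   : ∀ {A B D} →
              Tmap K (assocʳ {A} {B} {D}) ∘ τ ≈ τ ∘ (id ⁂ τ) ∘ assocʳ
    τ-η     : ∀ {A B} → τ ∘ (id {A} ⁂ η {B}) ≈ η
    τ-♯     : ∀ {A B D} {f : B ⇒ T D} →
              τ ∘ (id {A} ⁂ (f ♯)) ≈ (τ ∘ (id ⁂ f)) ♯ ∘ τ

record StrengthRespectsKleene {o ℓ e} {C : Category o ℓ e} (P : FiniteProducts C)
         (K : KleisliData C) (τ : Strength P K) (KK : KleeneKozen (Kleisli K))
         : Set (o ⊔ ℓ ⊔ e) where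
  open Category C
  open FiniteProducts P
  open KleisliData K
  open KleeneKozen KK
  field
    τ-⊥ : ∀ {A X Y} → τ ∘ (id {A} ⁂ ⊥ {X} {Y}) ≈ ⊥
    τ-∨ : ∀ {A X Y} {f g : X ⇒ T Y} →
          τ ∘ (id {A} ⁂ (f ∨ g)) ≈ (τ ∘ (id ⁂ f)) ∨ (τ ∘ (id ⁂ g))
    τ-* : ∀ {A X} {f : X ⇒ T X} →
          τ ∘ (id {A} ⁂ (f *)) ≈ (τ ∘ (id ⁂ f)) *

module _ {o ℓ e} {C : Category o ℓ e} (P : FiniteProducts C)
         (K : KleisliData C) (τ : Strength P K)
         (M : Category.Obj C)
         (ε : Category._⇒_ C (FiniteProducts.⊤ P) M)
         (_•_ : Category._⇒_ C (FiniteProducts._×ₒ_ P M M) M)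
         where
  open Category C
  open FiniteProducts P
  open KleisliData K

  _° : ∀ {X Y} → X ⇒ T (M ×ₒ Y) → M ×ₒ X ⇒ T (M ×ₒ Y)
  f ° = Tmap K (_•_ ⁂ id) ∘ Tmap K assocˡ ∘ τ ∘ (id ⁂ f)

  WriterT : KleisliData C
  WriterT = record
    { T  = λ X → T (M ×ₒ X)
    ; η  = η ∘ ⟨ ε ∘ ! , id ⟩
    ; _♯ = λ f → (f °) ♯
    }

module Submission where

-- Both Kleisli categories are built from the Kleisli category of T.
--
-- For the state transform, uncurrying is a fully faithful functor from the Kleisli
-- category of T_S to that of T (on objects X ↦ X × S), and a Kleene–Kozen structure is
-- reflected along any fully faithful functor: transport ∨, ⊥ and * through the bijection
-- on hom-sets.
--
-- For the writer transform, M × - lifts through the strength to a monad on the Kleisli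
-- category of T with unit u = η ∘ ⟨ ε ∘ ! , id ⟩ and extension f ↦ f°, and T_M is the
-- composite. Keeping the joins and ⊥ of T and putting f* := (f°)* · u gives a
-- Kleene–Kozen structure as soon as ° preserves joins, ⊥ and this star. The first two come
-- from the compatibility of τ with ∨ and ⊥. For the star, f° = μ · τ(id × f) with μ the
-- multiplication of logs, τ commutes with *, and μ · τ(id × f°) = f° · μ; the simulation
-- rule a · g = h · a ⇒ a · g* = h* · a then moves the star across μ.

open import Defs
open import Level using (_⊔_)
open import Data.Product using (_×_; proj₂; _,_)
open import Algebra.Structures using (IsIdempotentCommutativeMonoid)
open import Relation.Binary using (Setoid; IsEquivalence)
import Relation.Binary.Reasoning.Setoid as SetoidReasoning

module CategoryLemmas {o ℓ e} (C : Category o ℓ e) where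
  open Category C public
  module Eq {A B} = IsEquivalence (equiv {A} {B})
  open Eq public using (refl; sym; trans)

  hom-setoid : Obj → Obj → Setoid ℓ e
  hom-setoid A B = record { Carrier = A ⇒ B ; _≈_ = _≈_ ; isEquivalence = equiv }

  module HomReasoning {A B : Obj} = SetoidReasoning (hom-setoid A B)

  infixr 4 _⟩∘⟨_ refl⟩∘⟨_
  infixl 5 _⟩∘⟨refl

  _⟩∘⟨_ : ∀ {A B D} {f h : B ⇒ D} {g i : A ⇒ B} → f ≈ h → g ≈ i → f ∘ g ≈ h ∘ i
  _⟩∘⟨_ = ∘-resp-≈

  refl⟩∘⟨_ : ∀ {A B D} {f : B ⇒ D} {g i : A ⇒ B} → g ≈ i → f ∘ g ≈ f ∘ i
  refl⟩∘⟨ p = ∘-resp-≈ refl p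

  _⟩∘⟨refl : ∀ {A B D} {f h : B ⇒ D} {g : A ⇒ B} → f ≈ h → f ∘ g ≈ h ∘ g
  p ⟩∘⟨refl = ∘-resp-≈ p refl

  sym-assoc : ∀ {A B D E} {f : A ⇒ B} {g : B ⇒ D} {h : D ⇒ E} → h ∘ (g ∘ f) ≈ (h ∘ g) ∘ f
  sym-assoc = sym assoc

  cancel-≈id : ∀ {A B} {x : A ⇒ A} {f g : A ⇒ B} → x ≈ id → f ∘ x ≈ g ∘ x → f ≈ g
  cancel-≈id x≈id p =
    trans (sym identityʳ) (trans (refl⟩∘⟨ sym x≈id) (trans p (trans (refl⟩∘⟨ x≈id) identityʳ)))

module ProductLemmas {o ℓ e} {C : Category o ℓ e} (P : FiniteProducts C) where
  open CategoryLemmas C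
  open FiniteProducts P public

  ⟨⟩∘ : ∀ {X Y A B} {f : X ⇒ A} {g : X ⇒ B} {h : Y ⇒ X} → ⟨ f , g ⟩ ∘ h ≈ ⟨ f ∘ h , g ∘ h ⟩
  ⟨⟩∘ = sym (unique (trans sym-assoc (project₁ ⟩∘⟨refl)) (trans sym-assoc (project₂ ⟩∘⟨refl)))

  ⟨⟩-cong : ∀ {X A B} {f f′ : X ⇒ A} {g g′ : X ⇒ B} → f ≈ f′ → g ≈ g′ → ⟨ f , g ⟩ ≈ ⟨ f′ , g′ ⟩
  ⟨⟩-cong p q = sym (unique (trans project₁ p) (trans project₂ q))

  ⟨⟩-η : ∀ {X A B} {h : X ⇒ A ×ₒ B} → h ≈ ⟨ π₁ ∘ h , π₂ ∘ h ⟩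
  ⟨⟩-η = sym (unique refl refl)

  ⟨⟩-ext : ∀ {X A B} {h k : X ⇒ A ×ₒ B} → π₁ ∘ h ≈ π₁ ∘ k → π₂ ∘ h ≈ π₂ ∘ k → h ≈ k
  ⟨⟩-ext p q = trans ⟨⟩-η (unique (sym p) (sym q))

  π-η : ∀ {A B} → ⟨ π₁ , π₂ ⟩ ≈ id {A ×ₒ B}
  π-η = unique identityʳ identityʳ

  ⁂∘⟨⟩ : ∀ {X A B A′ B′} {f : A ⇒ A′} {g : B ⇒ B′} {h : X ⇒ A} {k : X ⇒ B} →
         (f ⁂ g) ∘ ⟨ h , k ⟩ ≈ ⟨ f ∘ h , g ∘ k ⟩
  ⁂∘⟨⟩ = trans ⟨⟩∘ (⟨⟩-cong (trans assoc (refl⟩∘⟨ project₁)) (trans assoc (refl⟩∘⟨ project₂)))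

  id⁂∘⟨⟩ : ∀ {X A B B′} {g : B ⇒ B′} {h : X ⇒ A} {k : X ⇒ B} →
           (id ⁂ g) ∘ ⟨ h , k ⟩ ≈ ⟨ h , g ∘ k ⟩
  id⁂∘⟨⟩ = trans ⁂∘⟨⟩ (⟨⟩-cong identityˡ refl)

  ⁂∘⁂ : ∀ {A B A′ B′ A″ B″} {f : A′ ⇒ A″} {g : B′ ⇒ B″} {h : A ⇒ A′} {k : B ⇒ B′} →
        (f ⁂ g) ∘ (h ⁂ k) ≈ (f ∘ h) ⁂ (g ∘ k)
  ⁂∘⁂ = trans ⁂∘⟨⟩ (⟨⟩-cong sym-assoc sym-assoc)

  ⁂-cong : ∀ {A B A′ B′} {f f′ : A ⇒ A′} {g g′ : B ⇒ B′} → f ≈ f′ → g ≈ g′ → f ⁂ g ≈ f′ ⁂ g′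
  ⁂-cong p q = ⟨⟩-cong (p ⟩∘⟨refl) (q ⟩∘⟨refl)

  id⁂id : ∀ {A B} → id {A} ⁂ id {B} ≈ id
  id⁂id = trans (⟨⟩-cong identityˡ identityˡ) π-η

  id⁂-∘ : ∀ {A X Y Z} {g : Y ⇒ Z} {f : X ⇒ Y} → id {A} ⁂ (g ∘ f) ≈ (id ⁂ g) ∘ (id ⁂ f)
  id⁂-∘ = sym (trans ⁂∘⁂ (⁂-cong identityˡ refl))

  !∘ : ∀ {A B} {h : A ⇒ B} → ! ∘ h ≈ !
  !∘ = !-unique _

  assocˡ∘⟨⟩ : ∀ {X A B D} {a : X ⇒ A} {b : X ⇒ B} {c : X ⇒ D} →
              assocˡ ∘ ⟨ a , ⟨ b , c ⟩ ⟩ ≈ ⟨ ⟨ a , b ⟩ , c ⟩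
  assocˡ∘⟨⟩ =
    trans ⟨⟩∘ (⟨⟩-cong (trans ⟨⟩∘ (⟨⟩-cong project₁ (trans assoc (trans (refl⟩∘⟨ project₂) project₁))))
                       (trans assoc (trans (refl⟩∘⟨ project₂) project₂)))

  assocʳ∘⟨⟩ : ∀ {X A B D} {a : X ⇒ A} {b : X ⇒ B} {c : X ⇒ D} →
              assocʳ ∘ ⟨ ⟨ a , b ⟩ , c ⟩ ≈ ⟨ a , ⟨ b , c ⟩ ⟩
  assocʳ∘⟨⟩ =
    trans ⟨⟩∘ (⟨⟩-cong (trans assoc (trans (refl⟩∘⟨ project₁) project₁))
                       (trans ⟨⟩∘ (⟨⟩-cong (trans assoc (trans (refl⟩∘⟨ project₁) project₂)) project₂)))

  assocˡ∘assocʳ : ∀ {A B D} → assocˡ ∘ assocʳ ≈ id {(A ×ₒ B) ×ₒ D}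
  assocˡ∘assocʳ =
    trans assocˡ∘⟨⟩ (trans (⟨⟩-cong (trans (sym ⟨⟩∘) (trans (π-η ⟩∘⟨refl) identityˡ)) refl) π-η)

  assocʳ∘assocˡ : ∀ {A B D} → assocʳ ∘ assocˡ ≈ id {A ×ₒ (B ×ₒ D)}
  assocʳ∘assocˡ =
    trans assocʳ∘⟨⟩ (trans (⟨⟩-cong refl (trans (sym ⟨⟩∘) (trans (π-η ⟩∘⟨refl) identityˡ))) π-η)

  assocˡ-natural : ∀ {A B D A′ B′ D′} {a : A ⇒ A′} {b : B ⇒ B′} {c : D ⇒ D′} →
                   ((a ⁂ b) ⁂ c) ∘ assocˡ ≈ assocˡ ∘ (a ⁂ (b ⁂ c))
  assocˡ-natural {a = a} {b} {c} = begin
      ((a ⁂ b) ⁂ c) ∘ assocˡ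
    ≈⟨ trans ⁂∘⟨⟩ (⟨⟩-cong (trans ⁂∘⟨⟩ (⟨⟩-cong refl sym-assoc)) sym-assoc) ⟩
      ⟨ ⟨ a ∘ π₁ , (b ∘ π₁) ∘ π₂ ⟩ , (c ∘ π₂) ∘ π₂ ⟩
    ≈⟨ sym assocˡ∘⟨⟩ ⟩
      assocˡ ∘ ⟨ a ∘ π₁ , ⟨ (b ∘ π₁) ∘ π₂ , (c ∘ π₂) ∘ π₂ ⟩ ⟩
    ≈⟨ refl⟩∘⟨ ⟨⟩-cong refl (sym ⟨⟩∘) ⟩
      assocˡ ∘ (a ⁂ (b ⁂ c)) ∎
    where open HomReasoning

module KleisliLemmas {o ℓ e} {C : Category o ℓ e} (K : KleisliData C) (KT : IsKleisliTriple K) where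
  open CategoryLemmas C
  open KleisliData K public
  open IsKleisliTriple KT public

  infixr 9 _·_
  _·_ : ∀ {X Y Z} → Y ⇒ T Z → X ⇒ T Y → X ⇒ T Z
  g · f = g ♯ ∘ f

  ·-resp-≈ : ∀ {X Y Z} {g g′ : Y ⇒ T Z} {f f′ : X ⇒ T Y} → g ≈ g′ → f ≈ f′ → g · f ≈ g′ · f′
  ·-resp-≈ p q = ♯-resp-≈ p ⟩∘⟨ q

  ·-assoc : ∀ {W X Y Z} {h : Y ⇒ T Z} {g : X ⇒ T Y} {f : W ⇒ T X} → (h · g) · f ≈ h · (g · f)
  ·-assoc = trans (♯♯ ⟩∘⟨refl) assoc

  ·-identityˡ : ∀ {X Y} {f : X ⇒ T Y} → η · f ≈ f
  ·-identityˡ = trans (η♯ ⟩∘⟨refl) identityˡ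

  ·-identityʳ : ∀ {X Y} {f : X ⇒ T Y} → f · η ≈ f
  ·-identityʳ = ♯η

  ·-pure : ∀ {W X Y} {g : X ⇒ T Y} {p : W ⇒ X} → g · (η ∘ p) ≈ g ∘ p
  ·-pure = trans sym-assoc (♯η ⟩∘⟨refl)

  Tm : ∀ {X Y} → X ⇒ Y → T X ⇒ T Y
  Tm = Tmap K

  Tm-cong : ∀ {X Y} {p q : X ⇒ Y} → p ≈ q → Tm p ≈ Tm q
  Tm-cong p = ♯-resp-≈ (refl⟩∘⟨ p)

  Tm-∘ : ∀ {X Y Z} {p : Y ⇒ Z} {q : X ⇒ Y} → Tm p ∘ Tm q ≈ Tm (p ∘ q)
  Tm-∘ = trans (sym ♯♯) (♯-resp-≈ (trans ·-pure assoc))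

  Tm-∘-assoc : ∀ {W X Y Z} {p : Y ⇒ Z} {q : X ⇒ Y} {h : W ⇒ T X} → Tm (p ∘ q) ∘ h ≈ Tm p ∘ (Tm q ∘ h)
  Tm-∘-assoc = sym (trans sym-assoc (Tm-∘ ⟩∘⟨refl))

  Tm-id : ∀ {X} → Tm (id {X}) ≈ id
  Tm-id = trans (♯-resp-≈ identityʳ) η♯

module JoinOrder {o ℓ e} {R : RawCat o ℓ e} (KK : KleeneKozen R) where
  open RawCat R using (Hom; _≈_)
  open KleeneKozen KK public
  module SL {A B} = IsIdempotentCommutativeMonoid (semilattice {A} {B})
  private
    module Eq {A B} = IsEquivalence (SL.isEquivalence {A} {B})
    open Eq using (refl; sym; trans)

  ∨-cong : ∀ {A B} {f f′ g g′ : Hom A B} → f ≈ f′ → g ≈ g′ → (f ∨ g) ≈ (f′ ∨ g′)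
  ∨-cong = SL.∙-cong

  ≤-resp-≈ : ∀ {A B} {f f′ g g′ : Hom A B} → f ≈ f′ → g ≈ g′ → f ≤ g → f′ ≤ g′
  ≤-resp-≈ p q f≤g = trans (∨-cong (sym p) (sym q)) (trans f≤g q)

  ≤-trans : ∀ {A B} {f g h : Hom A B} → f ≤ g → g ≤ h → f ≤ h
  ≤-trans {f = f} {g} {h} f≤g g≤h =
    trans (∨-cong refl (sym g≤h)) (trans (sym (SL.assoc f g h)) (trans (∨-cong f≤g refl) g≤h))

  ≤-antisym : ∀ {A B} {f g : Hom A B} → f ≤ g → g ≤ f → f ≈ g
  ≤-antisym {f = f} {g} f≤g g≤f = trans (sym g≤f) (trans (SL.comm g f) f≤g)

  ≤-∨ˡ : ∀ {A B} {f g : Hom A B} → f ≤ (f ∨ g)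
  ≤-∨ˡ {f = f} {g} = trans (sym (SL.assoc f f g)) (∨-cong (SL.idem f) refl)

  ≤-∨ʳ : ∀ {A B} {f g : Hom A B} → g ≤ (f ∨ g)
  ≤-∨ʳ {f = f} {g} = ≤-resp-≈ refl (SL.comm g f) ≤-∨ˡ

  ∨-lub : ∀ {A B} {f g h : Hom A B} → f ≤ h → g ≤ h → (f ∨ g) ≤ h
  ∨-lub {f = f} {g} {h} f≤h g≤h = trans (SL.assoc f g h) (trans (∨-cong refl g≤h) f≤h)

module KleisliStar {o ℓ e} {C : Category o ℓ e} (K : KleisliData C) (KT : IsKleisliTriple K)
                   (KK : KleeneKozen (Kleisli K)) where
  open CategoryLemmas C
  open KleisliLemmas K KT
  open JoinOrder KK public

  ·-monoˡ : ∀ {X Y Z} {g g′ : Y ⇒ T Z} {f : X ⇒ T Y} → g ≤ g′ → (g · f) ≤ (g′ · f)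
  ·-monoˡ g≤g′ = trans (sym ∘-∨ʳ) (·-resp-≈ g≤g′ refl)

  ·-monoʳ : ∀ {X Y Z} {g : Y ⇒ T Z} {f f′ : X ⇒ T Y} → f ≤ f′ → (g · f) ≤ (g · f′)
  ·-monoʳ f≤f′ = trans (sym ∘-∨ˡ) (·-resp-≈ refl f≤f′)

  η≤* : ∀ {X} {f : X ⇒ T X} → η ≤ (f *)
  η≤* = ≤-resp-≈ refl ·-identityˡ (≤-trans ≤-∨ˡ *-fixʳ)

  *·≤* : ∀ {X} {f : X ⇒ T X} → ((f *) · f) ≤ (f *)
  *·≤* = ≤-resp-≈ (·-resp-≈ ·-identityˡ refl) ·-identityˡ (≤-trans ≤-∨ʳ *-fixʳ)

  ·*≤* : ∀ {X} {f : X ⇒ T X} → (f · (f *)) ≤ (f *)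
  ·*≤* = ≤-resp-≈ (·-resp-≈ refl ·-identityʳ) ·-identityʳ (≤-trans ≤-∨ʳ *-fixˡ)

  *-simulation : ∀ {X Y} {g : X ⇒ T X} {f : Y ⇒ T Y} {a : X ⇒ T Y} →
                 (a · g) ≈ (f · a) → (a · (g *)) ≈ ((f *) · a)
  *-simulation {g = g} {f} {a} a·g≈f·a = ≤-antisym a·g*≤f*·a f*·a≤a·g*
    where
      a·g*≤f*·a : (a · (g *)) ≤ ((f *) · a)
      a·g*≤f*·a = *-leastʳ (∨-lub
        (≤-resp-≈ ·-identityˡ refl (·-monoˡ η≤*))
        (≤-resp-≈ (trans ·-assoc (trans (·-resp-≈ refl (sym a·g≈f·a)) (sym ·-assoc))) refl (·-monoˡ *·≤*)))
      f*·a≤a·g* : ((f *) · a) ≤ (a · (g *))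
      f*·a≤a·g* = *-leastˡ (∨-lub
        (≤-resp-≈ ·-identityʳ refl (·-monoʳ η≤*))
        (≤-resp-≈ (trans (sym ·-assoc) (trans (·-resp-≈ a·g≈f·a refl) ·-assoc)) refl (·-monoʳ ·*≤*)))

record FullyFaithful {o ℓ e o′ ℓ′ e′} (R : RawCat o ℓ e) (R′ : RawCat o′ ℓ′ e′)
                     : Set (o ⊔ ℓ ⊔ e ⊔ o′ ⊔ ℓ′ ⊔ e′) where
  private
    module R  = RawCat R
    module R′ = RawCat R′
  field
    F₀           : R.Obj → R′.Obj
    F₁           : ∀ {A B} → R.Hom A B → R′.Hom (F₀ A) (F₀ B)
    F₁⁻¹         : ∀ {A B} → R′.Hom (F₀ A) (F₀ B) → R.Hom A B
    F₁∘F₁⁻¹      : ∀ {A B} {h : R′.Hom (F₀ A) (F₀ B)} → F₁ (F₁⁻¹ h) R′.≈ h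
    F₁-injective : ∀ {A B} {f g : R.Hom A B} → F₁ f R′.≈ F₁ g → f R.≈ g
    F₁-resp-≈    : ∀ {A B} {f g : R.Hom A B} → f R.≈ g → F₁ f R′.≈ F₁ g
    F₁-∘         : ∀ {A B D} {g : R.Hom B D} {f : R.Hom A B} → F₁ (g R.∘ f) R′.≈ F₁ g R′.∘ F₁ f

module ReflectKleeneKozen {o ℓ e o′ ℓ′ e′} {R : RawCat o ℓ e} {R′ : RawCat o′ ℓ′ e′}
         (F : FullyFaithful R R′) (KK′ : KleeneKozen R′)
         (∘′-resp-≈ : ∀ {A B D} {f h : RawCat.Hom R′ B D} {g i : RawCat.Hom R′ A B} →
                      RawCat._≈_ R′ f h → RawCat._≈_ R′ g i →
                      RawCat._≈_ R′ (RawCat._∘_ R′ f g) (RawCat._∘_ R′ h i)) where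
  open RawCat R
  open FullyFaithful F
  private
    module R′ = RawCat R′
    module K′ = JoinOrder KK′
    module Eq′ {A B} = IsEquivalence (K′.SL.isEquivalence {A} {B})
    open Eq′ using () renaming (refl to refl′; sym to sym′; trans to trans′)

  infixr 6 _∨_
  _∨_ : ∀ {A B} → Hom A B → Hom A B → Hom A B
  f ∨ g = F₁⁻¹ (F₁ f K′.∨ F₁ g)

  ⊥ : ∀ {A B} → Hom A B
  ⊥ = F₁⁻¹ K′.⊥

  _* : ∀ {A} → Hom A A → Hom A A
  f * = F₁⁻¹ (F₁ f K′.*)

  ≈-isEquivalence : ∀ {A B} → IsEquivalence (_≈_ {A} {B})
  ≈-isEquivalence = record
    { refl  = F₁-injective refl′
    ; sym   = λ p → F₁-injective (sym′ (F₁-resp-≈ p))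
    ; trans = λ p q → F₁-injective (trans′ (F₁-resp-≈ p) (F₁-resp-≈ q))
    }

  F₁-∨ : ∀ {A B} {f g : Hom A B} → F₁ (f ∨ g) R′.≈ (F₁ f K′.∨ F₁ g)
  F₁-∨ = F₁∘F₁⁻¹

  F₁-∨-∘ : ∀ {A B D} {g : Hom A D} {x : Hom B D} {f : Hom A B} →
           F₁ (g ∨ (x ∘ f)) R′.≈ (F₁ g K′.∨ (F₁ x R′.∘ F₁ f))
  F₁-∨-∘ = trans′ F₁-∨ (K′.∨-cong refl′ F₁-∘)

  F₁-∘-* : ∀ {A D} {g : Hom A D} {f : Hom A A} → F₁ (g ∘ (f *)) R′.≈ (F₁ g R′.∘ (F₁ f K′.*))
  F₁-∘-* = trans′ F₁-∘ (∘′-resp-≈ refl′ F₁∘F₁⁻¹)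

  F₁-*-∘ : ∀ {A D} {f : Hom D D} {h : Hom A D} → F₁ ((f *) ∘ h) R′.≈ ((F₁ f K′.*) R′.∘ F₁ h)
  F₁-*-∘ = trans′ F₁-∘ (∘′-resp-≈ F₁∘F₁⁻¹ refl′)

  F₁-reflects-≤ : ∀ {A B} {f g : Hom A B} → (F₁ f K′.∨ F₁ g) R′.≈ F₁ g → (f ∨ g) ≈ g
  F₁-reflects-≤ f≤g = F₁-injective (trans′ F₁-∨ f≤g)

  F₁-preserves-≤ : ∀ {A B} {f g : Hom A B} → (f ∨ g) ≈ g → (F₁ f K′.∨ F₁ g) R′.≈ F₁ g
  F₁-preserves-≤ f≤g = trans′ (sym′ F₁-∨) (F₁-resp-≈ f≤g)

  F₁-injective-∨ : ∀ {A B} {x f g : Hom A B} → F₁ x R′.≈ (F₁ f K′.∨ F₁ g) → x ≈ (f ∨ g)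
  F₁-injective-∨ p = F₁-injective (trans′ p (sym′ F₁-∨))

  F₁-∨-∨ : ∀ {A B} {f g h k : Hom A B} →
           (F₁ f K′.∨ F₁ g) R′.≈ (F₁ h K′.∨ F₁ k) → (f ∨ g) ≈ (h ∨ k)
  F₁-∨-∨ p = F₁-injective-∨ (trans′ F₁-∨ p)

  kleeneKozen : KleeneKozen R
  kleeneKozen = record
    { _∨_ = _∨_
    ; ⊥ = ⊥
    ; _* = _*
    ; semilattice = record
      { isCommutativeMonoid = record
        { isMonoid = record
          { isSemigroup = record
            { isMagma = record
              { isEquivalence = ≈-isEquivalence
              ; ∙-cong = λ p q → F₁-∨-∨ (K′.∨-cong (F₁-resp-≈ p) (F₁-resp-≈ q))
              }
            ; assoc = λ _ _ _ → F₁-∨-∨ (trans′ (K′.∨-cong F₁-∨ refl′)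
                        (trans′ (K′.SL.assoc _ _ _) (K′.∨-cong refl′ (sym′ F₁-∨))))
            }
          ; identity = (λ _ → F₁-injective (trans′ F₁-∨ (trans′ (K′.∨-cong F₁∘F₁⁻¹ refl′) (K′.SL.identityˡ _))))
                     , (λ _ → F₁-injective (trans′ F₁-∨ (trans′ (K′.∨-cong refl′ F₁∘F₁⁻¹) (K′.SL.identityʳ _))))
          }
        ; comm = λ _ _ → F₁-∨-∨ (K′.SL.comm _ _)
        }
      ; idem = λ _ → F₁-injective (trans′ F₁-∨ (K′.SL.idem _))
      }
    ; ∘-∨ˡ = F₁-injective-∨ (trans′ F₁-∘ (trans′ (∘′-resp-≈ refl′ F₁-∨)
               (trans′ K′.∘-∨ˡ (K′.∨-cong (sym′ F₁-∘) (sym′ F₁-∘)))))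
    ; ∘-∨ʳ = F₁-injective-∨ (trans′ F₁-∘ (trans′ (∘′-resp-≈ F₁-∨ refl′)
               (trans′ K′.∘-∨ʳ (K′.∨-cong (sym′ F₁-∘) (sym′ F₁-∘)))))
    ; ∘-⊥ˡ = F₁-injective (trans′ F₁-∘ (trans′ (∘′-resp-≈ refl′ F₁∘F₁⁻¹) (trans′ K′.∘-⊥ˡ (sym′ F₁∘F₁⁻¹))))
    ; ∘-⊥ʳ = F₁-injective (trans′ F₁-∘ (trans′ (∘′-resp-≈ F₁∘F₁⁻¹ refl′) (trans′ K′.∘-⊥ʳ (sym′ F₁∘F₁⁻¹))))
    ; *-fixʳ = F₁-reflects-≤ (K′.≤-resp-≈ (sym′ (trans′ F₁-∨-∘ (K′.∨-cong refl′ (∘′-resp-≈ F₁-∘-* refl′))))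
                                          (sym′ F₁-∘-*) K′.*-fixʳ)
    ; *-leastʳ = λ p → F₁-reflects-≤ (K′.≤-resp-≈ (sym′ F₁-∘-*) refl′
                         (K′.*-leastʳ (K′.≤-resp-≈ F₁-∨-∘ refl′ (F₁-preserves-≤ p))))
    ; *-fixˡ = F₁-reflects-≤ (K′.≤-resp-≈ (sym′ (trans′ F₁-∨-∘ (K′.∨-cong refl′ (∘′-resp-≈ refl′ F₁-*-∘))))
                                          (sym′ F₁-*-∘) K′.*-fixˡ)
    ; *-leastˡ = λ p → F₁-reflects-≤ (K′.≤-resp-≈ (sym′ F₁-*-∘) refl′
                         (K′.*-leastˡ (K′.≤-resp-≈ F₁-∨-∘ refl′ (F₁-preserves-≤ p))))
    }

module StateTransform {o ℓ e} {C : Category o ℓ e} (P : FiniteProducts C)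
         (K : KleisliData C) (KT : IsKleisliTriple K) (KK : KleeneKozen (Kleisli K))
         (S : Category.Obj C)
         (exp : ∀ X → Exponential P S (KleisliData.T K (FiniteProducts._×ₒ_ P X S))) where
  open CategoryLemmas C
  open ProductLemmas P
  open KleisliLemmas K KT
  private
    module E X = Exponential (exp X)

  U : ∀ {W Y} → W ⇒ E.B^A Y → W ×ₒ S ⇒ T (Y ×ₒ S)
  U = uncurryS P K S exp

  U-λg : ∀ {W Y} {h : W ×ₒ S ⇒ T (Y ×ₒ S)} → U (E.λg Y h) ≈ h
  U-λg {Y = Y} = E.β Y

  U-cong : ∀ {W Y} {f g : W ⇒ E.B^A Y} → f ≈ g → U f ≈ U g
  U-cong p = refl⟩∘⟨ ⁂-cong p refl

  U-injective : ∀ {W Y} {f g : W ⇒ E.B^A Y} → U f ≈ U g → f ≈ g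
  U-injective {Y = Y} p = trans (E.λ-unique Y p) (sym (E.λ-unique Y refl))

  U-id : ∀ {Y} → U (id {E.B^A Y}) ≈ E.eval Y
  U-id = trans (refl⟩∘⟨ id⁂id) identityʳ

  U-∘ : ∀ {W Y Z} {g : Y ⇒ E.B^A Z} {f : W ⇒ E.B^A Y} →
        U (KleisliData._♯ (StateT P K S exp) g ∘ f) ≈ U g · U f
  U-∘ {Y = Y} {Z} {g} {f} = begin
      E.eval Z ∘ ((E.λg Z (U g ♯ ∘ E.eval Y) ∘ f) ⁂ id)
    ≈⟨ refl⟩∘⟨ sym (trans ⁂∘⁂ (⁂-cong refl identityˡ)) ⟩
      E.eval Z ∘ ((E.λg Z (U g ♯ ∘ E.eval Y) ⁂ id) ∘ (f ⁂ id))
    ≈⟨ sym-assoc ⟩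
      U (E.λg Z (U g ♯ ∘ E.eval Y)) ∘ (f ⁂ id)
    ≈⟨ U-λg ⟩∘⟨refl ⟩
      (U g ♯ ∘ E.eval Y) ∘ (f ⁂ id)
    ≈⟨ assoc ⟩
      U g · U f ∎
    where open HomReasoning

  isKleisliTriple : IsKleisliTriple (StateT P K S exp)
  isKleisliTriple = record
    { ♯-resp-≈ = λ p → E.λ-unique _ (trans U-λg (♯-resp-≈ (U-cong p) ⟩∘⟨refl))
    ; η♯ = U-injective (trans U-λg (trans (trans (♯-resp-≈ U-λg) η♯ ⟩∘⟨refl) (trans identityˡ (sym U-id))))
    ; ♯η = U-injective (trans U-∘ (trans (refl⟩∘⟨ U-λg) ♯η))
    ; ♯♯ = U-injective (trans U-λg (trans (trans (♯-resp-≈ U-∘) ♯♯ ⟩∘⟨refl)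
                         (trans assoc (sym (trans U-∘ (refl⟩∘⟨ U-λg))))))
    }

  uncurry-fullyFaithful : FullyFaithful (Kleisli (StateT P K S exp)) (Kleisli K)
  uncurry-fullyFaithful = record
    { F₀ = _×ₒ S
    ; F₁ = U
    ; F₁⁻¹ = E.λg _
    ; F₁∘F₁⁻¹ = U-λg
    ; F₁-injective = U-injective
    ; F₁-resp-≈ = U-cong
    ; F₁-∘ = U-∘
    }

  kleeneMonad : KleeneMonad (StateT P K S exp)
  kleeneMonad = isKleisliTriple , ReflectKleeneKozen.kleeneKozen uncurry-fullyFaithful KK ·-resp-≈

-- A Kleisli triple (G, u, _†) on the Kleisli category of T; its Kleisli category is that
-- of the composite monad T ∘ G.
record ContinuousExtension {o ℓ e} {C : Category o ℓ e} (K : KleisliData C)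
         (KK : KleeneKozen (Kleisli K)) : Set (o ⊔ ℓ ⊔ e) where
  open Category C
  open KleisliData K
  open KleeneKozen KK
  private
    _·_ : ∀ {X Y Z} → Y ⇒ T Z → X ⇒ T Y → X ⇒ T Z
    g · f = g ♯ ∘ f
  field
    G   : Obj → Obj
    u   : ∀ {X} → X ⇒ T (G X)
    _†  : ∀ {X Y} → X ⇒ T (G Y) → G X ⇒ T (G Y)
    †-resp-≈   : ∀ {X Y} {f g : X ⇒ T (G Y)} → f ≈ g → f † ≈ g †
    †-unit     : ∀ {X Y} {f : X ⇒ T (G Y)} → (f †) · u ≈ f
    unit-†     : ∀ {X} → u {X} † ≈ η
    †-·        : ∀ {X Y Z} {g : Y ⇒ T (G Z)} {f : X ⇒ T (G Y)} → ((g †) · f) † ≈ (g †) · (f †)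
    †-∨        : ∀ {X Y} {f g : X ⇒ T (G Y)} → (f ∨ g) † ≈ ((f †) ∨ (g †))
    †-⊥        : ∀ {X Y} → ⊥ {X} {G Y} † ≈ ⊥
    †-*        : ∀ {X} {f : X ⇒ T (G X)} → (((f †) *) · u) † ≈ (f †) *

  composite : KleisliData C
  composite = record { T = λ X → T (G X) ; η = u ; _♯ = λ f → (f †) ♯ }

module CompositeKleeneMonad {o ℓ e} {C : Category o ℓ e} {K : KleisliData C}
         (KT : IsKleisliTriple K) {KK : KleeneKozen (Kleisli K)}
         (ext : ContinuousExtension K KK) where
  open CategoryLemmas C
  open KleisliLemmas K KT
  open KleisliStar K KT KK
  open ContinuousExtension ext

  †-mono : ∀ {X Y} {f g : X ⇒ T (G Y)} → f ≤ g → (f †) ≤ (g †)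
  †-mono f≤g = trans (sym †-∨) (†-resp-≈ f≤g)

  isKleisliTriple : IsKleisliTriple composite
  isKleisliTriple = record
    { ♯-resp-≈ = λ p → ♯-resp-≈ (†-resp-≈ p)
    ; η♯ = trans (♯-resp-≈ unit-†) η♯
    ; ♯η = †-unit
    ; ♯♯ = trans (♯-resp-≈ †-·) ♯♯
    }

  kleeneKozen : KleeneKozen (Kleisli composite)
  kleeneKozen = record
    { _∨_ = _∨_
    ; ⊥ = ⊥
    ; _* = λ f → ((f †) *) · u
    ; semilattice = semilattice
    ; ∘-∨ˡ = ∘-∨ˡ
    ; ∘-∨ʳ = trans (·-resp-≈ †-∨ refl) ∘-∨ʳ
    ; ∘-⊥ˡ = ∘-⊥ˡ
    ; ∘-⊥ʳ = trans (·-resp-≈ †-⊥ refl) ∘-⊥ʳ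
    ; *-fixʳ = ≤-resp-≈
        (trans ∘-∨ʳ (∨-cong †-unit (trans ·-assoc (·-resp-≈ (sym (trans †-· (·-resp-≈ refl †-*))) †-unit))))
        ·-assoc (·-monoˡ *-fixʳ)
    ; *-leastʳ = λ p → ≤-resp-≈ ·-assoc †-unit
        (·-monoˡ (*-leastʳ (≤-resp-≈ (trans †-∨ (∨-cong refl †-·)) refl (†-mono p))))
    ; *-fixˡ = ≤-resp-≈ (sym (∨-cong refl (·-resp-≈ refl (·-resp-≈ †-* refl)))) (sym (·-resp-≈ †-* refl)) *-fixˡ
    ; *-leastˡ = λ p → ≤-resp-≈ (sym (·-resp-≈ †-* refl)) refl (*-leastˡ p)
    }

  kleeneMonad : KleeneMonad composite
  kleeneMonad = isKleisliTriple , kleeneKozen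

module MonoidObjectLemmas {o ℓ e} {C : Category o ℓ e} (P : FiniteProducts C)
         {M : Category.Obj C} {ε : Category._⇒_ C (FiniteProducts.⊤ P) M}
         {_•_ : Category._⇒_ C (FiniteProducts._×ₒ_ P M M) M}
         (mon : IsMonoidObj P M ε _•_) where
  open CategoryLemmas C
  open ProductLemmas P
  open IsMonoidObj mon
  open HomReasoning

  unit : ∀ {X} → X ⇒ M ×ₒ X
  unit = ⟨ ε ∘ ! , id ⟩

  mult : ∀ {Y} → M ×ₒ (M ×ₒ Y) ⇒ M ×ₒ Y
  mult = (_•_ ⁂ id) ∘ assocˡ

  ε!∘ : ∀ {A B} {z : A ⇒ B} → (ε ∘ !) ∘ z ≈ ε ∘ !
  ε!∘ = trans assoc (refl⟩∘⟨ !∘)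

  unit∘ : ∀ {A B} {z : A ⇒ B} → unit ∘ z ≈ ⟨ ε ∘ ! , z ⟩
  unit∘ = trans ⟨⟩∘ (⟨⟩-cong ε!∘ identityˡ)

  •-assoc-⟨⟩ : ∀ {X} {a b c : X ⇒ M} → _•_ ∘ ⟨ _•_ ∘ ⟨ a , b ⟩ , c ⟩ ≈ _•_ ∘ ⟨ a , _•_ ∘ ⟨ b , c ⟩ ⟩
  •-assoc-⟨⟩ {a = a} {b} {c} = begin
      _•_ ∘ ⟨ _•_ ∘ ⟨ a , b ⟩ , c ⟩
    ≈⟨ refl⟩∘⟨ sym (trans ⁂∘⟨⟩ (⟨⟩-cong refl identityˡ)) ⟩
      _•_ ∘ ((_•_ ⁂ id) ∘ ⟨ ⟨ a , b ⟩ , c ⟩)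
    ≈⟨ trans sym-assoc (•-assoc ⟩∘⟨refl) ⟩
      (_•_ ∘ (id ⁂ _•_) ∘ assocʳ) ∘ ⟨ ⟨ a , b ⟩ , c ⟩
    ≈⟨ trans assoc (refl⟩∘⟨ trans assoc (refl⟩∘⟨ assocʳ∘⟨⟩)) ⟩
      _•_ ∘ ((id ⁂ _•_) ∘ ⟨ a , ⟨ b , c ⟩ ⟩)
    ≈⟨ refl⟩∘⟨ id⁂∘⟨⟩ ⟩
      _•_ ∘ ⟨ a , _•_ ∘ ⟨ b , c ⟩ ⟩ ∎

  •-unitˡ-⟨⟩ : ∀ {X} {a : X ⇒ M} → _•_ ∘ ⟨ ε ∘ ! , a ⟩ ≈ a
  •-unitˡ-⟨⟩ {a = a} = begin
      _•_ ∘ ⟨ ε ∘ ! , a ⟩  ≈⟨ refl⟩∘⟨ sym unit∘ ⟩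
      _•_ ∘ (unit ∘ a)     ≈⟨ trans sym-assoc (•-unitˡ ⟩∘⟨refl) ⟩
      id ∘ a               ≈⟨ identityˡ ⟩
      a                    ∎

  •-unitʳ-⟨⟩ : ∀ {X} {a : X ⇒ M} → _•_ ∘ ⟨ a , ε ∘ ! ⟩ ≈ a
  •-unitʳ-⟨⟩ {a = a} = begin
      _•_ ∘ ⟨ a , ε ∘ ! ⟩               ≈⟨ refl⟩∘⟨ ⟨⟩-cong (sym identityˡ) (sym ε!∘) ⟩
      _•_ ∘ ⟨ id ∘ a , (ε ∘ !) ∘ a ⟩    ≈⟨ refl⟩∘⟨ sym ⟨⟩∘ ⟩
      _•_ ∘ (⟨ id , ε ∘ ! ⟩ ∘ a)        ≈⟨ trans sym-assoc (•-unitʳ ⟩∘⟨refl) ⟩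
      id ∘ a                            ≈⟨ identityˡ ⟩
      a                                 ∎

  mult∘⟨⟩ : ∀ {X Z} {a b : X ⇒ M} {c : X ⇒ Z} → mult ∘ ⟨ a , ⟨ b , c ⟩ ⟩ ≈ ⟨ _•_ ∘ ⟨ a , b ⟩ , c ⟩
  mult∘⟨⟩ = trans assoc (trans (refl⟩∘⟨ assocˡ∘⟨⟩) (trans ⁂∘⟨⟩ (⟨⟩-cong refl identityˡ)))

  mult∘unit : ∀ {Y} → mult {Y} ∘ unit ≈ id
  mult∘unit = cancel-≈id π-η (begin
      (mult ∘ unit) ∘ ⟨ π₁ , π₂ ⟩          ≈⟨ trans assoc (refl⟩∘⟨ unit∘) ⟩
      mult ∘ ⟨ ε ∘ ! , ⟨ π₁ , π₂ ⟩ ⟩       ≈⟨ mult∘⟨⟩ ⟩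
      ⟨ _•_ ∘ ⟨ ε ∘ ! , π₁ ⟩ , π₂ ⟩        ≈⟨ ⟨⟩-cong •-unitˡ-⟨⟩ refl ⟩
      ⟨ π₁ , π₂ ⟩                          ≈⟨ sym identityˡ ⟩
      id ∘ ⟨ π₁ , π₂ ⟩                     ∎)

  mult∘id⁂unit : ∀ {Y} → mult {Y} ∘ (id ⁂ unit) ≈ id
  mult∘id⁂unit = cancel-≈id π-η (begin
      (mult ∘ (id ⁂ unit)) ∘ ⟨ π₁ , π₂ ⟩   ≈⟨ trans assoc (refl⟩∘⟨ id⁂∘⟨⟩) ⟩
      mult ∘ ⟨ π₁ , unit ∘ π₂ ⟩            ≈⟨ refl⟩∘⟨ ⟨⟩-cong refl unit∘ ⟩
      mult ∘ ⟨ π₁ , ⟨ ε ∘ ! , π₂ ⟩ ⟩       ≈⟨ mult∘⟨⟩ ⟩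
      ⟨ _•_ ∘ ⟨ π₁ , ε ∘ ! ⟩ , π₂ ⟩        ≈⟨ ⟨⟩-cong •-unitʳ-⟨⟩ refl ⟩
      ⟨ π₁ , π₂ ⟩                          ≈⟨ sym identityˡ ⟩
      id ∘ ⟨ π₁ , π₂ ⟩                     ∎)

  mult-assoc : ∀ {Y} → mult {Y} ∘ (id ⁂ mult) ≈ mult ∘ mult
  mult-assoc {Y} = cancel-≈id split (begin
      (mult ∘ (id ⁂ mult)) ∘ ⟨ a , ⟨ b , ⟨ c , d ⟩ ⟩ ⟩  ≈⟨ trans assoc (refl⟩∘⟨ id⁂∘⟨⟩) ⟩
      mult ∘ ⟨ a , mult ∘ ⟨ b , ⟨ c , d ⟩ ⟩ ⟩           ≈⟨ refl⟩∘⟨ ⟨⟩-cong refl mult∘⟨⟩ ⟩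
      mult ∘ ⟨ a , ⟨ _•_ ∘ ⟨ b , c ⟩ , d ⟩ ⟩            ≈⟨ mult∘⟨⟩ ⟩
      ⟨ _•_ ∘ ⟨ a , _•_ ∘ ⟨ b , c ⟩ ⟩ , d ⟩             ≈⟨ ⟨⟩-cong (sym •-assoc-⟨⟩) refl ⟩
      ⟨ _•_ ∘ ⟨ _•_ ∘ ⟨ a , b ⟩ , c ⟩ , d ⟩             ≈⟨ sym mult∘⟨⟩ ⟩
      mult ∘ ⟨ _•_ ∘ ⟨ a , b ⟩ , ⟨ c , d ⟩ ⟩            ≈⟨ refl⟩∘⟨ sym mult∘⟨⟩ ⟩
      mult ∘ (mult ∘ ⟨ a , ⟨ b , ⟨ c , d ⟩ ⟩ ⟩)         ≈⟨ sym-assoc ⟩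
      (mult ∘ mult) ∘ ⟨ a , ⟨ b , ⟨ c , d ⟩ ⟩ ⟩         ∎)
    where
      a = π₁
      b = π₁ ∘ π₂
      c = π₁ ∘ (π₂ ∘ π₂)
      d = π₂ ∘ (π₂ ∘ π₂)
      split : ⟨ a , ⟨ b , ⟨ c , d ⟩ ⟩ ⟩ ≈ id {M ×ₒ (M ×ₒ (M ×ₒ Y))}
      split = sym (trans ⟨⟩-η (⟨⟩-cong identityʳ (trans identityʳ (trans ⟨⟩-η (⟨⟩-cong refl (trans ⟨⟩-η refl))))))

module StrengthLemmas {o ℓ e} {C : Category o ℓ e} (P : FiniteProducts C)
         (K : KleisliData C) (KT : IsKleisliTriple K)
         {τ : Strength P K} (isS : IsStrength P K τ) where
  open CategoryLemmas C
  open ProductLemmas P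
  open KleisliLemmas K KT
  private module τ = IsStrength isS
  open HomReasoning

  strong : ∀ {A X Y} → X ⇒ T Y → A ×ₒ X ⇒ T (A ×ₒ Y)
  strong f = τ ∘ (id ⁂ f)

  strong-cong : ∀ {A X Y} {f g : X ⇒ T Y} → f ≈ g → strong {A} f ≈ strong g
  strong-cong p = refl⟩∘⟨ ⁂-cong refl p

  strong-· : ∀ {A X Y Z} {g : Y ⇒ T Z} {f : X ⇒ T Y} → strong {A} (g · f) ≈ strong g · strong f
  strong-· = trans (refl⟩∘⟨ id⁂-∘) (trans sym-assoc (trans (τ.τ-♯ ⟩∘⟨refl) assoc))

  strong-η : ∀ {A X Y} {p : X ⇒ Y} → strong {A} (η ∘ p) ≈ η ∘ (id ⁂ p)
  strong-η = trans (refl⟩∘⟨ id⁂-∘) (trans sym-assoc (τ.τ-η ⟩∘⟨refl))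

  τ-naturalˡ : ∀ {A A′ B} {p : A ⇒ A′} → τ {A′} {B} ∘ (p ⁂ id) ≈ Tm (p ⁂ id) ∘ τ
  τ-naturalˡ = trans (refl⟩∘⟨ ⁂-cong refl (sym Tm-id)) τ.natural

  τ∘⟨!,⟩ : ∀ {X Y} {f : X ⇒ T Y} → τ ∘ ⟨ ! , f ⟩ ≈ Tm ⟨ ! , id ⟩ ∘ f
  τ∘⟨!,⟩ {f = f} = begin
      τ ∘ ⟨ ! , f ⟩                                 ≈⟨ sym identityˡ ⟩
      id ∘ (τ ∘ ⟨ ! , f ⟩)                          ≈⟨ sym (trans Tm-∘ (trans (Tm-cong ⟨!,id⟩∘π₂) Tm-id)) ⟩∘⟨refl ⟩
      (Tm ⟨ ! , id ⟩ ∘ Tm π₂) ∘ (τ ∘ ⟨ ! , f ⟩)     ≈⟨ trans assoc (refl⟩∘⟨ trans sym-assoc (τ.unit ⟩∘⟨refl)) ⟩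
      Tm ⟨ ! , id ⟩ ∘ (π₂ ∘ ⟨ ! , f ⟩)              ≈⟨ refl⟩∘⟨ project₂ ⟩
      Tm ⟨ ! , id ⟩ ∘ f                             ∎
    where
      ⟨!,id⟩∘π₂ : ∀ {Y} → ⟨ ! , id ⟩ ∘ π₂ ≈ id {⊤ ×ₒ Y}
      ⟨!,id⟩∘π₂ = ⟨⟩-ext (trans sym-assoc (trans (project₁ ⟩∘⟨refl) (trans !∘ (sym (trans identityʳ (!-unique π₁))))))
                         (trans sym-assoc (trans (project₂ ⟩∘⟨refl) (trans identityˡ (sym identityʳ))))

  τ∘assocˡ : ∀ {A B D} → τ ∘ assocˡ {A} {B} {T D} ≈ Tm assocˡ ∘ (τ ∘ (id ⁂ τ))
  τ∘assocˡ = begin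
      τ ∘ assocˡ                                    ≈⟨ sym identityˡ ⟩
      id ∘ (τ ∘ assocˡ)                             ≈⟨ sym (trans Tm-∘ (trans (Tm-cong assocˡ∘assocʳ) Tm-id)) ⟩∘⟨refl ⟩
      (Tm assocˡ ∘ Tm assocʳ) ∘ (τ ∘ assocˡ)        ≈⟨ trans assoc (refl⟩∘⟨ trans sym-assoc (τ.assoc ⟩∘⟨refl)) ⟩
      Tm assocˡ ∘ ((τ ∘ ((id ⁂ τ) ∘ assocʳ)) ∘ assocˡ)
        ≈⟨ refl⟩∘⟨ trans (sym-assoc ⟩∘⟨refl) (trans assoc (trans (refl⟩∘⟨ assocʳ∘assocˡ) identityʳ)) ⟩
      Tm assocˡ ∘ (τ ∘ (id ⁂ τ))                    ∎

module WriterTransform {o ℓ e} {C : Category o ℓ e} (P : FiniteProducts C)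
         (K : KleisliData C) (KT : IsKleisliTriple K) (KK : KleeneKozen (Kleisli K))
         (M : Category.Obj C)
         (ε : Category._⇒_ C (FiniteProducts.⊤ P) M)
         (_•_ : Category._⇒_ C (FiniteProducts._×ₒ_ P M M) M)
         (mon : IsMonoidObj P M ε _•_)
         (τ : Strength P K) (isS : IsStrength P K τ)
         (rK : StrengthRespectsKleene P K τ KK) where
  open CategoryLemmas C
  open ProductLemmas P
  open KleisliLemmas K KT
  open KleisliStar K KT KK
  open MonoidObjectLemmas P mon
  open StrengthLemmas P K KT isS
  open StrengthRespectsKleene rK
  open HomReasoning

  infix 10 _°′
  _°′ : ∀ {X Y} → X ⇒ T (M ×ₒ Y) → M ×ₒ X ⇒ T (M ×ₒ Y)
  f °′ = _° P K τ M ε _•_ f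

  μ : ∀ {Y} → M ×ₒ (M ×ₒ Y) ⇒ T (M ×ₒ Y)
  μ = η ∘ mult

  °-strong : ∀ {X Y} {f : X ⇒ T (M ×ₒ Y)} → f °′ ≈ μ · strong f
  °-strong = trans sym-assoc (Tm-∘ ⟩∘⟨refl)

  °-resp-≈ : ∀ {X Y} {f g : X ⇒ T (M ×ₒ Y)} → f ≈ g → f °′ ≈ g °′
  °-resp-≈ p = trans °-strong (trans (·-resp-≈ refl (strong-cong p)) (sym °-strong))

  °-∘-unit : ∀ {X Y} {f : X ⇒ T (M ×ₒ Y)} → f °′ ∘ unit ≈ f
  °-∘-unit {f = f} = begin
      f °′ ∘ unit
    ≈⟨ trans (°-strong ⟩∘⟨refl) (trans assoc (refl⟩∘⟨ assoc)) ⟩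
      Tm mult ∘ (τ ∘ ((id ⁂ f) ∘ unit))
    ≈⟨ refl⟩∘⟨ refl⟩∘⟨ trans id⁂∘⟨⟩ (trans (⟨⟩-cong refl (trans identityʳ (sym identityˡ))) (sym ⁂∘⟨⟩)) ⟩
      Tm mult ∘ (τ ∘ ((ε ⁂ id) ∘ ⟨ ! , f ⟩))
    ≈⟨ refl⟩∘⟨ trans sym-assoc (trans (τ-naturalˡ ⟩∘⟨refl) (trans assoc (refl⟩∘⟨ τ∘⟨!,⟩))) ⟩
      Tm mult ∘ (Tm (ε ⁂ id) ∘ (Tm ⟨ ! , id ⟩ ∘ f))
    ≈⟨ trans sym-assoc (trans (Tm-∘ ⟩∘⟨refl) (trans sym-assoc (Tm-∘ ⟩∘⟨refl))) ⟩
      Tm ((mult ∘ (ε ⁂ id)) ∘ ⟨ ! , id ⟩) ∘ f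
    ≈⟨ Tm-cong (trans assoc (trans (refl⟩∘⟨ trans ⁂∘⟨⟩ (⟨⟩-cong refl identityˡ)) mult∘unit)) ⟩∘⟨refl ⟩
      Tm id ∘ f
    ≈⟨ trans (Tm-id ⟩∘⟨refl) identityˡ ⟩
      f ∎

  °-unit : ∀ {X Y} {f : X ⇒ T (M ×ₒ Y)} → f °′ · (η ∘ unit) ≈ f
  °-unit = trans ·-pure °-∘-unit

  unit-° : ∀ {X} → (η ∘ unit {X}) °′ ≈ η
  unit-° = trans °-strong (trans (·-resp-≈ refl strong-η)
                 (trans ·-pure (trans assoc (trans (refl⟩∘⟨ mult∘id⁂unit) identityʳ))))

  μ-strong-° : ∀ {X Y} {k : X ⇒ T (M ×ₒ Y)} → μ · strong (k °′) ≈ k °′ · μ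
  μ-strong-° {k = k} = begin
      μ · strong (k °′)
    ≈⟨ ·-resp-≈ refl (trans (strong-cong °-strong) strong-·) ⟩
      μ · (strong μ · strong (strong k))
    ≈⟨ trans (sym ·-assoc) (·-resp-≈ (trans (·-resp-≈ refl strong-η) (trans ·-pure assoc)) refl) ⟩
      (η ∘ (mult ∘ (id ⁂ mult))) · strong (strong k)
    ≈⟨ ·-resp-≈ (refl⟩∘⟨ mult-assoc) refl ⟩
      Tm (mult ∘ mult) ∘ (τ ∘ (id ⁂ (τ ∘ (id ⁂ k))))
    ≈⟨ refl⟩∘⟨ trans (refl⟩∘⟨ id⁂-∘) sym-assoc ⟩
      Tm (mult ∘ mult) ∘ ((τ ∘ (id ⁂ τ)) ∘ Z)
    ≈⟨ Tm-∘-assoc ⟩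
      Tm mult ∘ (Tm mult ∘ ((τ ∘ (id ⁂ τ)) ∘ Z))
    ≈⟨ refl⟩∘⟨ Tm-∘-assoc ⟩
      Tm mult ∘ (Tm (_•_ ⁂ id) ∘ (Tm assocˡ ∘ ((τ ∘ (id ⁂ τ)) ∘ Z)))
    ≈⟨ refl⟩∘⟨ refl⟩∘⟨ trans sym-assoc (sym τ∘assocˡ ⟩∘⟨refl) ⟩
      Tm mult ∘ (Tm (_•_ ⁂ id) ∘ ((τ ∘ assocˡ) ∘ Z))
    ≈⟨ refl⟩∘⟨ trans (refl⟩∘⟨ assoc) (trans sym-assoc (sym τ-naturalˡ ⟩∘⟨refl)) ⟩
      Tm mult ∘ ((τ ∘ (_•_ ⁂ id)) ∘ (assocˡ ∘ Z))
    ≈⟨ refl⟩∘⟨ trans assoc (refl⟩∘⟨ sym id⁂k∘mult) ⟩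
      Tm mult ∘ (τ ∘ ((id ⁂ k) ∘ mult))
    ≈⟨ trans (refl⟩∘⟨ sym-assoc) (trans sym-assoc (sym °-strong ⟩∘⟨refl)) ⟩
      k °′ ∘ mult
    ≈⟨ sym ·-pure ⟩
      k °′ · μ ∎
    where
      Z = id ⁂ (id ⁂ k)
      id⁂k∘mult : (id ⁂ k) ∘ mult ≈ (_•_ ⁂ id) ∘ (assocˡ ∘ Z)
      id⁂k∘mult = begin
          (id ⁂ k) ∘ ((_•_ ⁂ id) ∘ assocˡ)   ≈⟨ trans sym-assoc (trans ⁂∘⁂ (⁂-cong identityˡ identityʳ) ⟩∘⟨refl) ⟩
          (_•_ ⁂ k) ∘ assocˡ                 ≈⟨ sym (trans ⁂∘⁂ (⁂-cong identityʳ identityˡ)) ⟩∘⟨refl ⟩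
          ((_•_ ⁂ id) ∘ (id ⁂ k)) ∘ assocˡ   ≈⟨ trans assoc (refl⟩∘⟨ (⁂-cong (sym id⁂id) refl ⟩∘⟨refl)) ⟩
          (_•_ ⁂ id) ∘ (((id ⁂ id) ⁂ k) ∘ assocˡ) ≈⟨ refl⟩∘⟨ assocˡ-natural ⟩
          (_•_ ⁂ id) ∘ (assocˡ ∘ Z)          ∎

  °-· : ∀ {X Y Z} {g : Y ⇒ T (M ×ₒ Z)} {f : X ⇒ T (M ×ₒ Y)} → (g °′ · f) °′ ≈ g °′ · f °′
  °-· = begin
      (_ °′ · _) °′                   ≈⟨ trans °-strong (·-resp-≈ refl strong-·) ⟩
      μ · (strong (_ °′) · strong _)  ≈⟨ trans (sym ·-assoc) (·-resp-≈ μ-strong-° refl) ⟩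
      (_ °′ · μ) · strong _           ≈⟨ trans ·-assoc (·-resp-≈ refl (sym °-strong)) ⟩
      _ °′ · _ °′                     ∎

  °-∨ : ∀ {X Y} {f g : X ⇒ T (M ×ₒ Y)} → (f ∨ g) °′ ≈ (f °′ ∨ g °′)
  °-∨ = trans °-strong (trans (·-resp-≈ refl τ-∨) (trans ∘-∨ˡ (∨-cong (sym °-strong) (sym °-strong))))

  °-⊥ : ∀ {X Y} → (⊥ {X} {M ×ₒ Y}) °′ ≈ ⊥
  °-⊥ = trans °-strong (trans (·-resp-≈ refl τ-⊥) ∘-⊥ˡ)

  °-* : ∀ {X} {f : X ⇒ T (M ×ₒ X)} → ((f °′) * · (η ∘ unit)) °′ ≈ (f °′) *
  °-* {f = f} = begin
      ((f °′) * · (η ∘ unit)) °′                ≈⟨ trans °-strong (·-resp-≈ refl strong-·) ⟩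
      μ · (strong ((f °′) *) · strong (η ∘ unit)) ≈⟨ ·-resp-≈ refl (·-resp-≈ τ-* strong-η) ⟩
      μ · ((strong (f °′)) * · (η ∘ (id ⁂ unit))) ≈⟨ sym ·-assoc ⟩
      (μ · (strong (f °′)) *) · (η ∘ (id ⁂ unit)) ≈⟨ ·-resp-≈ (*-simulation μ-strong-°) refl ⟩
      ((f °′) * · μ) · (η ∘ (id ⁂ unit))        ≈⟨ ·-assoc ⟩
      (f °′) * · (μ · (η ∘ (id ⁂ unit)))        ≈⟨ ·-resp-≈ refl (trans ·-pure (trans assoc (trans (refl⟩∘⟨ mult∘id⁂unit) identityʳ))) ⟩
      (f °′) * · η                              ≈⟨ ·-identityʳ ⟩
      (f °′) *                                  ∎

  continuousExtension : ContinuousExtension K KK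
  continuousExtension = record
    { G = M ×ₒ_
    ; u = η ∘ unit
    ; _† = _°′
    ; †-resp-≈ = °-resp-≈
    ; †-unit = °-unit
    ; unit-† = unit-°
    ; †-· = °-·
    ; †-∨ = °-∨
    ; †-⊥ = °-⊥
    ; †-* = °-*
    }

  kleeneMonad : KleeneMonad (WriterT P K τ M ε _•_)
  kleeneMonad = CompositeKleeneMonad.kleeneMonad KT continuousExtension

proposition3 : ∀ {o ℓ e} (C : Category o ℓ e) (P : FiniteProducts C)
    (K : KleisliData C) (km : KleeneMonad K) →
    ((S : Category.Obj C)
      (exp : ∀ X → Exponential P S (KleisliData.T K (FiniteProducts._×ₒ_ P X S))) →
      KleeneMonad (StateT P K S exp))
    × ((M : Category.Obj C)
      (ε : Category._⇒_ C (FiniteProducts.⊤ P) M)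
      (_•_ : Category._⇒_ C (FiniteProducts._×ₒ_ P M M) M) →
      IsMonoidObj P M ε _•_ →
      (τ : Strength P K) → IsStrength P K τ →
      StrengthRespectsKleene P K τ (proj₂ km) →
      KleeneMonad (WriterT P K τ M ε _•_))
proposition3 C P K (kt , kk) =
    (λ S exp → StateTransform.kleeneMonad P K kt kk S exp)
  , (λ M ε _•_ mon τ isS rK → WriterTransform.kleeneMonad P K kt kk M ε _•_ mon τ isS rK)
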